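{- Let $k>30$ be an integer. Let $T=\varphi(k)+\omega(k)$, let $p_T$ be the $T$-th prime, and let $t$ be the integer with $tk<p_T<(t+1)k$. Put $L=t-1$ if $p_T\in(tk,tk+\frac k2)$ and $L=t$ if $p_T\in(tk+\frac k2,tk+k)$. If $$S_L:=\sum_{n=0}^{L}\left(2\pi\left(nk+\frac k2\right)-\pi(nk)-\pi(nk+k)\right)>\log k,$$ then $k$ is not a $P$-integer.
   Context: $\varphi$ is Euler's totient function and $\omega(k)$ is the number of distinct prime divisors of $k$. $p_1<p_2<\dots$ is the increasing sequence of all primes. For real $x>1$, $\pi(x)$ is the number of primes not exceeding $x$, and $\pi(x)=0$ for $0\le x\le 1$. The integer $k>1$ is called a $P$-integer if the first $\varphi(k)$ primes coprime to $k$ form a reduced residue system modulo $k$. -}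

module Defs where

open import Data.Nat using (ℕ; zero; suc; _+_; _*_; _^_; _<_; _≤_; _!; _/_)
open import Data.Nat.Primality using (Prime; prime?)
open import Data.Nat.Coprimality using (Coprime; coprime?)
open import Data.Nat.Divisibility using (_∣_; _∣?_)
open import Data.List using (List; length; filter; upTo; map)
open import Data.Integer as ℤ using (ℤ; +_)
open import Data.Integer.Divisibility using () renaming (_∣_ to _ℤ∣_)
open import Data.Product using (_×_; ∃)
open import Relation.Nullary.Decidable using (_×-dec_)
open import Relation.Binary.PropositionalEquality using (_≡_)

-- primeCount n = π(n) = number of primes p ≤ n  (π(x) = π(⌊x⌋) for real x ≥ 0)
primeCount : ℕ → ℕ
primeCount n = length (filter prime? (upTo (suc n)))

φ : ℕ → ℕ
φ k = length (filter (λ m → coprime? m k) (map suc (upTo k)))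

ω : ℕ → ℕ
ω k = length (filter (λ p → prime? p ×-dec (p ∣? k)) (upTo (suc k)))

-- p is the T-th prime (1-indexed): p prime and exactly T primes are ≤ p
IsNthPrime : ℕ → ℕ → Set
IsNthPrime T p = Prime p × primeCount p ≡ T

primeCoprimeCount : ℕ → ℕ → ℕ
primeCoprimeCount k n = length (filter (λ q → prime? q ×-dec coprime? q k) (upTo (suc n)))

-- q is the j-th (1-indexed) prime coprime to k
IsNthPrimeCoprime : ℕ → ℕ → ℕ → Set
IsNthPrimeCoprime k j q = Prime q × Coprime q k × primeCoprimeCount k q ≡ j

-- k is a P-integer: k > 1 and the first φ(k) primes coprime to k form a
-- reduced residue system mod k, i.e. (being φ(k) residues coprime to k)
-- they are pairwise incongruent modulo k.
PInteger : ℕ → Set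
PInteger k = 1 < k ×
  (∀ i j q r → 1 ≤ i → i ≤ φ k → 1 ≤ j → j ≤ φ k →
     IsNthPrimeCoprime k i q → IsNthPrimeCoprime k j r →
     (+ k) ℤ∣ (+ q ℤ.- + r) → i ≡ j)

-- n-th term: 2π(nk + k/2) − π(nk) − π(nk + k)   (π(nk+k/2) = π(⌊(2nk+k)/2⌋))
term : ℕ → ℕ → ℤ
term k n = (+ 2) ℤ.* (+ primeCount ((2 * n * k + k) / 2))
           ℤ.- (+ primeCount (n * k)) ℤ.- (+ primeCount (n * k + k))

-- sumTerms k M = Σ_{n=0}^{M-1} term k n ; so S_L = sumTerms k (L + 1)
sumTerms : ℕ → ℕ → ℤ
sumTerms k zero = + 0
sumTerms k (suc M) = sumTerms k M ℤ.+ term k M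

-- expPartial s N = N! * Σ_{j=0}^{N} s^j / j!   (a natural number)
expPartial : ℕ → ℕ → ℕ
expPartial s zero = 1
expPartial s (suc N) = suc N * expPartial s N + s ^ suc N

-- LogLt k s  :⇔  log k < s  ⇔  k < e^s  ⇔  some partial sum of the exponential
-- series Σ s^j/j! exceeds k (partial sums increase to e^s).
LogLt : ℕ → ℕ → Set
LogLt k s = ∃ λ N → k * N ! < expPartial s N

module Submission where

-- Call x ≥ 1 low if x ≡ a (mod k) with 1 ≤ a ≤ ⌊k/2⌋, and high otherwise.  Assume k is a P-integer.
--   * Every prime ≤ p either divides k (all ω(k) of these are ≤ k < p) or is coprime to k, so the
--     primes ≤ p coprime to k are exactly the first φ(k) of them.  By the P-property they lie in
--     distinct reduced classes; since a ↦ k − a maps low units injectively to high units, at most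
--     as many of them are low as are high.
--   * Each term of S_L counts low minus high primes in one block (n k, n k + k], so S_L is the
--     bias #low − #high of the primes ≤ (L+1) k.  The choice of L means that the primes between p
--     and (L+1) k only strengthen the inequality above, so S_L ≤ #(low prime divisors of k) ≤ ω(k).
--   * The product of the distinct prime divisors of k divides k, so (ω(k)+1)! ≤ k; and
--     e^s ≤ max(31, (s+1)!), so s ≤ ω(k) forces s ≤ log k, contradicting S_L > log k.
-- The file develops, in order: counting hits of a decidable predicate below n; bounds for the
-- partial sums of the exponential series; the factorial bound for ω(k); residues modulo k and the
-- two halves; the telescoping of S_L; the balance for P-integers; and finally the theorem.

open import Level using (0ℓ)
open import Data.Bool using (true; false; if_then_else_)
open import Data.Nat
open import Data.Nat.Properties
open import Data.Nat.DivMod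
open import Data.Nat.Divisibility
open import Data.Nat.Primality using (Prime; prime?; euclidsLemma; prime⇒nonTrivial; prime⇒irreducible)
open import Data.Nat.Coprimality using (Coprime; coprime?; coprime-divisor; 1-coprimeTo)
open import Data.Nat.Tactic.RingSolver using (solve-∀)
open import Data.Product using (_×_; _,_; proj₁; proj₂)
open import Data.Sum using (_⊎_; inj₁; inj₂; [_,_]′)
open import Data.List using (length; filter; applyUpTo; _++_; [_])
open import Data.List.Properties using (filter-++; length-++; applyUpTo-∷ʳ; map-upTo)
open import Function using (_∘_; _⇔_; mk⇔)
open import Relation.Binary.Definitions using (tri<; tri≈; tri>)
open import Relation.Binary.PropositionalEquality hiding ([_])
open import Relation.Nullary using (¬_; Dec; yes; no; does; contradiction; ¬?; _×-dec_)
open import Relation.Nullary.Decidable using (does-⇔; decidable-stable; from-yes)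
open import Relation.Unary using (Pred; Decidable; ∁)
open import Relation.Unary.Properties using (_∩?_; ∁?)
import Data.Integer as ℤ
open ℤ using (ℤ)
import Data.Integer.Properties as ℤ
import Data.Integer.Tactic.RingSolver as ℤ-Solver
open import Data.Integer.Divisibility using () renaming (_∣_ to _∣ℤ_)
open import Defs

indicator : ∀ {a} {A : Set a} → Dec A → ℕ
indicator a? = if does a? then 1 else 0

count : ∀ {ℓ} {P : Pred ℕ ℓ} → Decidable P → ℕ → ℕ
count P? zero    = 0
count P? (suc n) = count P? n + indicator (P? n)

module _ {ℓ} {P : Pred ℕ ℓ} (P? : Decidable P) where

  -- the list filters used in Defs are counts (upTo = applyUpTo id, map suc (upTo n) = applyUpTo suc n)
  count-filter : (f : ℕ → ℕ) (n : ℕ) →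
                 length (filter P? (applyUpTo f n)) ≡ count (P? ∘ f) n
  count-filter f zero    = refl
  count-filter f (suc n) = begin
    length (filter P? (applyUpTo f (suc n)))
      ≡⟨ cong (length ∘ filter P?) (applyUpTo-∷ʳ f n) ⟨
    length (filter P? (applyUpTo f n ++ [ f n ]))
      ≡⟨ cong length (filter-++ P? (applyUpTo f n) [ f n ]) ⟩
    length (filter P? (applyUpTo f n) ++ filter P? [ f n ])
      ≡⟨ length-++ (filter P? (applyUpTo f n)) ⟩
    length (filter P? (applyUpTo f n)) + length (filter P? [ f n ])
      ≡⟨ cong₂ _+_ (count-filter f n) (singleton (f n)) ⟩
    count (P? ∘ f) (suc n) ∎
    where
    open ≡-Reasoning
    singleton : ∀ x → length (filter P? [ x ]) ≡ indicator (P? x)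
    singleton x with does (P? x)
    ... | true  = refl
    ... | false = refl

  count-hit : ∀ {x} → P x → count P? (suc x) ≡ suc (count P? x)
  count-hit {x} px with P? x
  ... | yes _  = +-comm (count P? x) 1
  ... | no ¬px = contradiction px ¬px

  count-miss : ∀ {x} → ¬ P x → count P? (suc x) ≡ count P? x
  count-miss {x} ¬px with P? x
  ... | yes px = contradiction px ¬px
  ... | no _   = +-identityʳ (count P? x)

  count-monoʳ : ∀ {m n} → m ≤ n → count P? m ≤ count P? n
  count-monoʳ {m} {zero} z≤n = z≤n
  count-monoʳ {m} {suc n} m≤1+n with m≤n⇒m<n∨m≡n m≤1+n
  ... | inj₂ refl = ≤-refl
  ... | inj₁ m<1+n = ≤-trans (count-monoʳ (≤-pred m<1+n)) (m≤m+n (count P? n) _)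

  count-growth : ∀ {m n} → m ≤ n → count P? n ≤ count P? m + (n ∸ m)
  count-growth {m} {zero} z≤n = z≤n
  count-growth {m} {suc n} m≤1+n with m≤n⇒m<n∨m≡n m≤1+n
  ... | inj₂ refl = m≤m+n (count P? (suc n)) _
  ... | inj₁ m<1+n = begin
    count P? n + indicator (P? n)       ≤⟨ +-mono-≤ (count-growth (≤-pred m<1+n)) (indicator≤1 (P? n)) ⟩
    count P? m + (n ∸ m) + 1            ≡⟨ +-assoc (count P? m) (n ∸ m) 1 ⟩
    count P? m + (n ∸ m + 1)            ≡⟨ cong (count P? m +_) (+-comm (n ∸ m) 1) ⟩
    count P? m + suc (n ∸ m)            ≡⟨ cong (count P? m +_) (+-∸-assoc 1 (≤-pred m<1+n)) ⟨
    count P? m + (suc n ∸ m) ∎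
    where
    open ≤-Reasoning
    indicator≤1 : ∀ {a} {A : Set a} (a? : Dec A) → indicator a? ≤ 1
    indicator≤1 (yes _) = ≤-refl
    indicator≤1 (no _)  = z≤n

  count-stable : ∀ {m n} → m ≤ n → (∀ x → m ≤ x → x < n → ¬ P x) →
                 count P? n ≡ count P? m
  count-stable {m} {zero} z≤n none = refl
  count-stable {m} {suc n} m≤1+n none with m≤n⇒m<n∨m≡n m≤1+n
  ... | inj₂ refl = refl
  ... | inj₁ m<1+n = begin
    count P? (suc n) ≡⟨ count-miss (none n (≤-pred m<1+n) ≤-refl) ⟩
    count P? n       ≡⟨ count-stable (≤-pred m<1+n) (λ x m≤x x<n → none x m≤x (m≤n⇒m≤1+n x<n)) ⟩
    count P? m       ∎
    where open ≡-Reasoning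

  count-shift : ∀ n → count P? (suc n) ≡ indicator (P? 0) + count (P? ∘ suc) n
  count-shift zero    = +-comm 0 (indicator (P? 0))
  count-shift (suc n) = begin
    count P? (suc n) + indicator (P? (suc n))
      ≡⟨ cong (_+ indicator (P? (suc n))) (count-shift n) ⟩
    indicator (P? 0) + count (P? ∘ suc) n + indicator (P? (suc n))
      ≡⟨ +-assoc (indicator (P? 0)) _ _ ⟩
    indicator (P? 0) + count (P? ∘ suc) (suc n) ∎
    where open ≡-Reasoning

module _ {ℓ ℓ′} {P : Pred ℕ ℓ} {Q : Pred ℕ ℓ′} (P? : Decidable P) (Q? : Decidable Q) where

  count-cong : ∀ n → (∀ x → x < n → P x ⇔ Q x) → count P? n ≡ count Q? n
  count-cong zero    _   = refl
  count-cong (suc n) P⇔Q = cong₂ _+_ (count-cong n (λ x x<n → P⇔Q x (m≤n⇒m≤1+n x<n)))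
                                     (cong (λ b → if b then 1 else 0) (does-⇔ (P⇔Q n ≤-refl) (P? n) (Q? n)))

  count-mono : ∀ n → (∀ x → x < n → P x → Q x) → count P? n ≤ count Q? n
  count-mono zero    _   = z≤n
  count-mono (suc n) P⇒Q = +-mono-≤ (count-mono n (λ x x<n → P⇒Q x (m≤n⇒m≤1+n x<n))) (step (P? n) (Q? n))
    where
    step : (p? : Dec (P n)) (q? : Dec (Q n)) → indicator p? ≤ indicator q?
    step (yes p) (yes _) = ≤-refl
    step (yes p) (no ¬q) = contradiction (P⇒Q n ≤-refl p) ¬q
    step (no _)  q?      = z≤n

  count-split : ∀ n → count P? n ≡ count (P? ∩? Q?) n + count (P? ∩? ∁? Q?) n
  count-split zero    = refl
  count-split (suc n) = trans (cong (_+ indicator (P? n)) (count-split n)) (step (P? n) (Q? n))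
    where
    a = count (P? ∩? Q?) n
    b = count (P? ∩? ∁? Q?) n
    step : (p? : Dec (P n)) (q? : Dec (Q n)) →
           a + b + indicator p? ≡ a + indicator (p? ×-dec q?) + (b + indicator (p? ×-dec ¬? q?))
    step (yes _) (yes _) = shuffle a b
      where shuffle : ∀ a b → a + b + 1 ≡ a + 1 + (b + 0)
            shuffle = solve-∀
    step (yes _) (no _)  = shuffle a b
      where shuffle : ∀ a b → a + b + 1 ≡ a + 0 + (b + 1)
            shuffle = solve-∀
    step (no _)  q?      = shuffle a b
      where shuffle : ∀ a b → a + b + 0 ≡ a + 0 + (b + 0)
            shuffle = solve-∀

module _ {ℓ} {P : Pred ℕ ℓ} (P? : Decidable P) where

  count-remove : ∀ {y n} → P y → y < n → count P? n ≡ suc (count (P? ∩? ∁? (_≟ y)) n)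
  count-remove {y} {n} py y<n = begin
    count P? n
      ≡⟨ count-split P? (_≟ y) n ⟩
    count (P? ∩? (_≟ y)) n + count (P? ∩? ∁? (_≟ y)) n
      ≡⟨ cong (_+ count (P? ∩? ∁? (_≟ y)) n) single ⟩
    suc (count (P? ∩? ∁? (_≟ y)) n) ∎
    where
    open ≡-Reasoning
    single : count (P? ∩? (_≟ y)) n ≡ 1
    single = begin
      count (P? ∩? (_≟ y)) n
        ≡⟨ count-stable (P? ∩? (_≟ y)) y<n (λ x y<x _ (_ , x≡y) → <⇒≢ y<x (sym x≡y)) ⟩
      count (P? ∩? (_≟ y)) (suc y)
        ≡⟨ count-hit (P? ∩? (_≟ y)) (py , refl) ⟩
      suc (count (P? ∩? (_≟ y)) y)
        ≡⟨ cong suc (count-stable (P? ∩? (_≟ y)) z≤n (λ x _ x<y (_ , x≡y) → <⇒≢ x<y x≡y)) ⟩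
      1 ∎

count-inj : ∀ {ℓ ℓ′} {P : Pred ℕ ℓ} {Q : Pred ℕ ℓ′} (P? : Decidable P) (Q? : Decidable Q)
            (g : ℕ → ℕ) (n m : ℕ) →
            (∀ x → x < n → P x → g x < m × Q (g x)) →
            (∀ x y → x < n → y < n → P x → P y → g x ≡ g y → x ≡ y) →
            count P? n ≤ count Q? m
count-inj P? Q? g zero    m maps inj = z≤n
count-inj {Q = Q} P? Q? g (suc n) m maps inj with P? n
... | no _   = ≤-trans (≤-reflexive (+-identityʳ (count P? n)))
                       (count-inj P? Q? g n m (λ x x<n → maps x (m≤n⇒m≤1+n x<n))
                                              (λ x y x<n y<n → inj x y (m≤n⇒m≤1+n x<n) (m≤n⇒m≤1+n y<n)))
... | yes pn = begin
  count P? n + 1                        ≡⟨ +-comm (count P? n) 1 ⟩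
  suc (count P? n)                      ≤⟨ s≤s rest ⟩
  suc (count (Q? ∩? ∁? (_≟ g n)) m)      ≡⟨ count-remove Q? (proj₂ g[n]) (proj₁ g[n]) ⟨
  count Q? m                            ∎
  where
  open ≤-Reasoning
  g[n] : g n < m × Q (g n)
  g[n] = maps n ≤-refl pn
  rest : count P? n ≤ count (Q? ∩? ∁? (_≟ g n)) m
  rest = count-inj P? (Q? ∩? ∁? (_≟ g n)) g n m
    (λ x x<n px → proj₁ (maps x (m≤n⇒m≤1+n x<n) px) ,
                  proj₂ (maps x (m≤n⇒m≤1+n x<n) px) ,
                  λ gx≡gn → <⇒≢ x<n (inj x n (m≤n⇒m≤1+n x<n) ≤-refl px pn gx≡gn))
    (λ x y x<n y<n → inj x y (m≤n⇒m≤1+n x<n) (m≤n⇒m≤1+n y<n))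

count-strict : ∀ {ℓ ℓ′} {P : Pred ℕ ℓ} {Q : Pred ℕ ℓ′} (P? : Decidable P) (Q? : Decidable Q)
               {n x₀ : ℕ} →
               (∀ x → x < n → P x → Q x) → x₀ < n → Q x₀ → ¬ P x₀ →
               count P? n < count Q? n
count-strict P? Q? {n} {x₀} P⇒Q x₀<n qx₀ ¬px₀ = begin-strict
  count P? n                         <⟨ s≤s (count-mono P? (Q? ∩? ∁? (_≟ x₀)) n
                                           (λ x x<n px → P⇒Q x x<n px , λ { refl → ¬px₀ px })) ⟩
  suc (count (Q? ∩? ∁? (_≟ x₀)) n)    ≡⟨ count-remove Q? qx₀ x₀<n ⟨
  count Q? n                         ∎
  where open ≤-Reasoning

-- hits are strictly ordered by their rank, so the rank determines the hit
count-rank-< : ∀ {ℓ} {P : Pred ℕ ℓ} (P? : Decidable P) {x y : ℕ} → P y → x < y →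
               count P? (suc x) < count P? (suc y)
count-rank-< P? py x<y = ≤-trans (s≤s (count-monoʳ P? x<y)) (≤-reflexive (sym (count-hit P? py)))

count-rank-injective : ∀ {ℓ} {P : Pred ℕ ℓ} (P? : Decidable P) {x y : ℕ} → P x → P y →
                       count P? (suc x) ≡ count P? (suc y) → x ≡ y
count-rank-injective P? {x} {y} px py same with <-cmp x y
... | tri≈ _ x≡y _ = x≡y
... | tri< x<y _ _ = contradiction same (<⇒≢ (count-rank-< P? py x<y))
... | tri> _ _ y<x = contradiction (sym same) (<⇒≢ (count-rank-< P? px y<x))

expPartial-increasing : ∀ s {N M} → N ≤ M → expPartial s N * M ! ≤ expPartial s M * N !
expPartial-increasing s {N} {zero}  z≤n = ≤-refl
expPartial-increasing s {N} {suc M} N≤1+M with m≤n⇒m<n∨m≡n N≤1+M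
... | inj₂ refl = ≤-refl
... | inj₁ N<1+M = begin
  expPartial s N * (suc M * M !)            ≡⟨ reorder (expPartial s N) (suc M) (M !) ⟩
  suc M * (expPartial s N * M !)            ≤⟨ *-monoʳ-≤ (suc M) (expPartial-increasing s (≤-pred N<1+M)) ⟩
  suc M * (expPartial s M * N !)            ≡⟨ *-assoc (suc M) (expPartial s M) (N !) ⟨
  suc M * expPartial s M * N !              ≤⟨ *-monoˡ-≤ (N !) (m≤m+n (suc M * expPartial s M) (s ^ suc M)) ⟩
  expPartial s (suc M) * N !                ∎
  where
  open ≤-Reasoning
  reorder : ∀ a b c → a * (b * c) ≡ b * (a * c)
  reorder = solve-∀

-- for N ≥ s the terms decay by a factor s/(N+1) ≤ 1, so (expPartial s N + s^(N+1)) / N! decreases: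
-- a bound at N = s propagates to all larger N
expPartial-tail : ∀ s C {N} → s ≤ N → expPartial s s + s ^ suc s ≤ C * s ! →
                  expPartial s N + s ^ suc N ≤ C * N !
expPartial-tail s C {zero}  z≤n base = base
expPartial-tail s C {suc N} s≤1+N base with m≤n⇒m<n∨m≡n s≤1+N
... | inj₂ refl = base
... | inj₁ s<1+N = begin
  suc N * E + x + s * x          ≤⟨ +-monoʳ-≤ (suc N * E + x) (*-monoˡ-≤ x (≤-pred s<1+N)) ⟩
  suc N * E + x + N * x          ≡⟨ collect N E x ⟩
  suc N * (E + x)                ≤⟨ *-monoʳ-≤ (suc N) (expPartial-tail s C (≤-pred s<1+N) base) ⟩
  suc N * (C * N !)              ≡⟨ reorder (suc N) C (N !) ⟩
  C * (suc N * N !)              ∎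
  where
  open ≤-Reasoning
  E = expPartial s N
  x = s ^ suc N
  collect : ∀ n e x → suc n * e + x + n * x ≡ suc n * (e + x)
  collect = solve-∀
  reorder : ∀ a b c → a * (b * c) ≡ b * (a * c)
  reorder = solve-∀

expPartial-bound : ∀ s C → expPartial s s + s ^ suc s ≤ C * s ! → ∀ N → expPartial s N ≤ C * N !
expPartial-bound s C base N with ≤-total N s
... | inj₂ s≤N = ≤-trans (m≤m+n _ _) (expPartial-tail s C s≤N base)
... | inj₁ N≤s = *-cancelʳ-≤ (expPartial s N) (C * N !) (s !) {{s !≢0}} (begin
  expPartial s N * s !    ≤⟨ expPartial-increasing s N≤s ⟩
  expPartial s s * N !    ≤⟨ *-monoˡ-≤ (N !) (≤-trans (m≤m+n _ (s ^ suc s)) base) ⟩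
  C * s ! * N !           ≡⟨ swap C (s !) (N !) ⟩
  C * N ! * s !           ∎)
  where
  open ≤-Reasoning
  swap : ∀ a b c → a * b * c ≡ a * c * b
  swap = solve-∀

-- for N ≤ s each of the N + 1 summands N! s^j / j! is at most s^N
expPartial≤terms : ∀ s {N} → N ≤ s → expPartial s N ≤ suc N * s ^ N
expPartial≤terms s {zero}  _     = ≤-refl
expPartial≤terms s {suc N} 1+N≤s = begin
  suc N * expPartial s N + s ^ suc N
    ≤⟨ +-monoˡ-≤ (s ^ suc N) (*-monoʳ-≤ (suc N) (expPartial≤terms s (<⇒≤ 1+N≤s))) ⟩
  suc N * (suc N * s ^ N) + s ^ suc N
    ≤⟨ +-monoˡ-≤ (s ^ suc N) (*-monoʳ-≤ (suc N) (*-monoˡ-≤ (s ^ N) 1+N≤s)) ⟩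
  suc N * (s * s ^ N) + s * s ^ N
    ≡⟨ +-comm (suc N * (s * s ^ N)) (s * s ^ N) ⟩
  suc (suc N) * s ^ suc N ∎
  where open ≤-Reasoning

-- pairing the factors i and b + a + 1 − i of a! (b+a)! / b!, each pair is at least b + a
factorial-pairing : ∀ a b → (b + a) ^ a * b ! ≤ a ! * (b + a) !
factorial-pairing zero    b = ≤-reflexive (cong (λ n → n ! + 0) (sym (+-identityʳ b)))
factorial-pairing (suc a) b = *-cancelˡ-≤ (suc b) (begin
  suc b * (c * c ^ a * b !)           ≡⟨ reorder (suc b) c (c ^ a) (b !) ⟩
  c * (c ^ a * (suc b * b !))         ≤⟨ *-monoʳ-≤ c induction ⟩
  c * (a ! * c !)                     ≤⟨ *-monoˡ-≤ (a ! * c !) (sum≤product a b) ⟩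
  suc a * suc b * (a ! * c !)         ≡⟨ reorder′ (suc a) (suc b) (a !) (c !) ⟩
  suc b * (suc a * a ! * c !)         ∎)
  where
  open ≤-Reasoning
  c = b + suc a
  induction : c ^ a * suc b ! ≤ a ! * c !
  induction = subst (λ n → n ^ a * suc b ! ≤ a ! * n !) (sym (+-suc b a)) (factorial-pairing a (suc b))
  reorder : ∀ x y z w → x * (y * z * w) ≡ y * (z * (x * w))
  reorder = solve-∀
  reorder′ : ∀ x y z w → x * y * (z * w) ≡ y * (x * z * w)
  reorder′ = solve-∀
  sum≤product : ∀ a b → b + suc a ≤ suc a * suc b
  sum≤product a b = ≤-trans (≤-reflexive (+-suc b a)) (s≤s (+-monoʳ-≤ b (m≤m*n a (suc b))))

-- (2s + 1) s^s ≤ (s + 1) (s!)² for s ≥ 4, from factorial-pairing with a = s − 3, b = 3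
power≤factorial² : ∀ m → (2 * (4 + m) + 1) * (4 + m) ^ (4 + m) ≤ (5 + m) * ((4 + m) ! * (4 + m) !)
power≤factorial² m = begin
  (2 * (4 + m) + 1) * (4 + m) ^ (4 + m)                ≤⟨ m≤m+n _ slack ⟩
  (2 * (4 + m) + 1) * (4 + m) ^ (4 + m) + slack        ≡⟨ polynomial m X ⟩
  c * (X * 3 !)                                        ≤⟨ *-monoʳ-≤ c (factorial-pairing (1 + m) 3) ⟩
  c * ((1 + m) ! * (4 + m) !)                          ≡⟨ factorials m ((1 + m) !) ((4 + m) !) ⟩
  (5 + m) * ((4 + m) ! * (4 + m) !)                    ∎
  where
  open ≤-Reasoning
  X = (4 + m) ^ (1 + m)
  c = (5 + m) * ((4 + m) * (3 + m) * (2 + m))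
  slack = (4 + m) * (4 * m * m * m + 35 * m * m + 82 * m + 36) * X
  polynomial : ∀ m X → (2 * (4 + m) + 1) * ((4 + m) * ((4 + m) * ((4 + m) * X)))
                         + (4 + m) * (4 * m * m * m + 35 * m * m + 82 * m + 36) * X
                       ≡ (5 + m) * ((4 + m) * (3 + m) * (2 + m)) * (X * 6)
  polynomial = solve-∀
  factorials : ∀ m F G → (5 + m) * ((4 + m) * (3 + m) * (2 + m)) * (F * G)
                         ≡ (5 + m) * (((4 + m) * ((3 + m) * ((2 + m) * F))) * G)
  factorials = solve-∀

-- the starting bound with C = k: checked directly for s ≤ 3 (C = 31 suffices), via (s+1)! ≤ k otherwise
expPartial-start : ∀ {k} s → 30 < k → (suc s) ! ≤ k → expPartial s s + s ^ suc s ≤ k * s !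
expPartial-start 0 k>30 _ = ≤-trans (from-yes (expPartial 0 0 + 0 ^ 1 ≤? 31 * 0 !)) (*-monoˡ-≤ (0 !) k>30)
expPartial-start 1 k>30 _ = ≤-trans (from-yes (expPartial 1 1 + 1 ^ 2 ≤? 31 * 1 !)) (*-monoˡ-≤ (1 !) k>30)
expPartial-start 2 k>30 _ = ≤-trans (from-yes (expPartial 2 2 + 2 ^ 3 ≤? 31 * 2 !)) (*-monoˡ-≤ (2 !) k>30)
expPartial-start 3 k>30 _ = ≤-trans (from-yes (expPartial 3 3 + 3 ^ 4 ≤? 31 * 3 !)) (*-monoˡ-≤ (3 !) k>30)
expPartial-start {k} s@(suc (suc (suc (suc m)))) _ [s+1]!≤k = begin
  expPartial s s + s * s ^ s      ≤⟨ +-monoˡ-≤ (s * s ^ s) (expPartial≤terms s ≤-refl) ⟩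
  suc s * s ^ s + s * s ^ s       ≡⟨ double s (s ^ s) ⟩
  (2 * s + 1) * s ^ s             ≤⟨ power≤factorial² m ⟩
  suc s * (s ! * s !)             ≡⟨ *-assoc (suc s) (s !) (s !) ⟨
  suc s ! * s !                   ≤⟨ *-monoˡ-≤ (s !) [s+1]!≤k ⟩
  k * s !                         ∎
  where
  open ≤-Reasoning
  double : ∀ s x → suc s * x + s * x ≡ (2 * s + 1) * x
  double = solve-∀

-- e^s ≤ max(31, (s+1)!): if k > 30 and (s+1)! ≤ k then s ≤ log k
log-lower-bound : ∀ {k s} → 30 < k → (suc s) ! ≤ k → ¬ LogLt k s
log-lower-bound {k} {s} k>30 [s+1]!≤k (N , kN!<E) =
  <⇒≱ kN!<E (expPartial-bound s k (expPartial-start s k>30 [s+1]!≤k) N)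

prime≥2 : ∀ {p} → Prime p → 2 ≤ p
prime≥2 {p} pr = nonTrivial⇒n>1 p {{prime⇒nonTrivial pr}}

prime∤⇒coprime : ∀ {p n} → Prime p → ¬ p ∣ n → Coprime p n
prime∤⇒coprime pr p∤n (d∣p , d∣n) with prime⇒irreducible pr d∣p
... | inj₁ d≡1 = d≡1
... | inj₂ refl = contradiction d∣n p∤n

coprime⇒prime∤ : ∀ {p n} → Prime p → Coprime p n → ¬ p ∣ n
coprime⇒prime∤ pr cop p∣n = <⇒≢ (prime≥2 pr) (sym (cop (∣-refl , p∣n)))

noncoprime⇒prime∣ : ∀ {p n} → Prime p → ¬ Coprime p n → p ∣ n
noncoprime⇒prime∣ {p} {n} pr ¬cop = decidable-stable (p ∣? n) (¬cop ∘ prime∤⇒coprime pr)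

count-primes : ∀ {ℓ} {P : Pred ℕ ℓ} (P? : Decidable P) → (∀ {x} → P x → Prime x) →
               ∀ {n} → 2 ≤ n → count P? n + 2 ≤ n
count-primes P? P⇒prime {n} 2≤n = begin
  count P? n + 2              ≤⟨ +-monoˡ-≤ 2 (count-growth P? 2≤n) ⟩
  count P? 2 + (n ∸ 2) + 2    ≡⟨ cong (λ c → c + (n ∸ 2) + 2) none-below-2 ⟩
  n ∸ 2 + 2                   ≡⟨ m∸n+n≡m 2≤n ⟩
  n                           ∎
  where
  open ≤-Reasoning
  none-below-2 : count P? 2 ≡ 0
  none-below-2 = count-stable P? z≤n (λ x _ x<2 px → <⇒≱ x<2 (prime≥2 (P⇒prime px)))

module _ (k : ℕ) where

  PrimeDivisor : Pred ℕ 0ℓ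
  PrimeDivisor p = Prime p × p ∣ k

  primeDivisor? : Decidable PrimeDivisor
  primeDivisor? p = prime? p ×-dec p ∣? k

  radicalBelow : ℕ → ℕ
  radicalBelow zero    = 1
  radicalBelow (suc B) = if does (primeDivisor? B) then B * radicalBelow B else radicalBelow B

  radical-prime∤ : ∀ {p} B → Prime p → B ≤ p → ¬ p ∣ radicalBelow B
  radical-prime∤ zero    pr _ p∣1 = <⇒≢ (prime≥2 pr) (sym (∣1⇒≡1 p∣1))
  radical-prime∤ {p} (suc B) pr B<p with prime? B | B ∣? k
  ... | no _    | _     = radical-prime∤ B pr (<⇒≤ B<p)
  ... | yes _   | no _  = radical-prime∤ B pr (<⇒≤ B<p)
  ... | yes prB | yes _ = λ p∣B*r → [ p∤B , radical-prime∤ B pr (<⇒≤ B<p) ]′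
                                        (euclidsLemma B (radicalBelow B) pr p∣B*r)
    where
    p∤B : ¬ p ∣ B
    p∤B p∣B = <⇒≱ B<p (∣⇒≤ {{>-nonZero (≤-trans (s≤s z≤n) (prime≥2 prB))}} p∣B)

  radical-∣ : ∀ B → radicalBelow B ∣ k
  radical-∣ zero    = 1∣ k
  radical-∣ (suc B) with prime? B | B ∣? k
  ... | no _    | _       = radical-∣ B
  ... | yes _   | no _    = radical-∣ B
  ... | yes prB | yes B∣k with radical-∣ B
  ...   | divides c k≡c*r = subst (B * radicalBelow B ∣_) (sym k≡c*r) (*-monoˡ-∣ (radicalBelow B) B∣c)
    where
    B∣c : B ∣ c
    B∣c = coprime-divisor (prime∤⇒coprime prB (radical-prime∤ B prB ≤-refl))
                          (subst (B ∣_) (trans k≡c*r (*-comm c (radicalBelow B))) B∣k)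

  -- the i-th prime divisor is at least i + 1, so the product of c of them is at least (c + 1)!
  radical-≥ : ∀ B → (suc (count primeDivisor? B)) ! ≤ radicalBelow B
  radical-≥ zero    = ≤-refl
  radical-≥ (suc B) with prime? B | B ∣? k
  ... | no _    | _     = subst (λ c → (suc c) ! ≤ radicalBelow B) (sym (+-identityʳ c)) (radical-≥ B)
    where c = count primeDivisor? B
  ... | yes _   | no _  = subst (λ c → (suc c) ! ≤ radicalBelow B) (sym (+-identityʳ c)) (radical-≥ B)
    where c = count primeDivisor? B
  ... | yes prB | yes _ = subst (λ c → (suc c) ! ≤ B * radicalBelow B) (+-comm 1 c)
                            (*-mono-≤ (≤-trans (≤-reflexive (+-comm 2 c)) (count-primes primeDivisor? proj₁ (prime≥2 prB)))
                                      (radical-≥ B))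
    where c = count primeDivisor? B

ω≡count : ∀ k → ω k ≡ count (primeDivisor? k) (suc k)
ω≡count k = count-filter (primeDivisor? k) (λ p → p) (suc k)

omega-factorial : ∀ {k} → 0 < k → (suc (ω k)) ! ≤ k
omega-factorial {k} 0<k = begin
  (suc (ω k)) !                                ≡⟨ cong (λ w → (suc w) !) (ω≡count k) ⟩
  (suc (count (primeDivisor? k) (suc k))) !    ≤⟨ radical-≥ k (suc k) ⟩
  radicalBelow k (suc k)                       ≤⟨ ∣⇒≤ {{>-nonZero 0<k}} (radical-∣ k (suc k)) ⟩
  k                                            ∎
  where open ≤-Reasoning

factorial-mono : ∀ {m n} → m ≤ n → m ! ≤ n !
factorial-mono {n = n} m≤n = ∣⇒≤ {{n !≢0}} (m≤n⇒m!∣n! m≤n)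

block-offset : ∀ n x → n < x → suc (n + (x ∸ suc n)) ≡ x
block-offset n x n<x = m+[n∸m]≡n n<x

module _ (k : ℕ) .{{_ : NonZero k}} where

  half : ℕ
  half = k / 2

  -- the residue class of x ≥ 1 modulo k, represented in 0,…,k-1 (class a ∈ {1,…,k} ↦ a ∸ 1)
  residue : ℕ → ℕ
  residue x = (x ∸ 1) % k

  -- the class a ∈ {1,…,k} of x lies in the lower half {1,…,⌊k/2⌋}
  Low : Pred ℕ 0ℓ
  Low x = residue x < half

  low? : Decidable Low
  low? x = residue x <? half

  high? : Decidable (∁ Low)
  high? = ∁? low?

  twice-half≤ : 2 * half ≤ k
  twice-half≤ = begin
    2 * half              ≡⟨ *-comm 2 half ⟩
    half * 2              ≤⟨ m≤n+m (half * 2) (k % 2) ⟩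
    k % 2 + half * 2      ≡⟨ m≡m%n+[m/n]*n k 2 ⟨
    k                     ∎
    where open ≤-Reasoning

  ≤twice-half+1 : k ≤ suc (2 * half)
  ≤twice-half+1 = begin
    k                     ≡⟨ m≡m%n+[m/n]*n k 2 ⟩
    k % 2 + half * 2      ≤⟨ +-monoˡ-≤ (half * 2) (≤-pred (m%n<n k 2)) ⟩
    suc (half * 2)        ≡⟨ cong suc (*-comm half 2) ⟩
    suc (2 * half)        ∎
    where open ≤-Reasoning

  residue-block : ∀ n j → j < k → residue (n * k + suc j) ≡ j
  residue-block n j j<k = begin
    (n * k + suc j ∸ 1) % k    ≡⟨ cong (λ x → (x ∸ 1) % k) (+-suc (n * k) j) ⟩
    (n * k + j) % k            ≡⟨ cong (_% k) (+-comm (n * k) j) ⟩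
    (j + n * k) % k            ≡⟨ [m+kn]%n≡m%n j n k ⟩
    j % k                      ≡⟨ m<n⇒m%n≡m j<k ⟩
    j                          ∎
    where open ≡-Reasoning

  block-residue : ∀ n x → n * k < x → x ≤ n * k + k → residue x ≡ x ∸ suc (n * k)
  block-residue n x nk<x x≤nk+k = trans (cong residue x≡) (residue-block n j j<k)
    where
    j = x ∸ suc (n * k)
    x≡ : x ≡ n * k + suc j
    x≡ = trans (sym (block-offset (n * k) x nk<x)) (sym (+-suc (n * k) j))
    j<k : j < k
    j<k = +-cancelˡ-< (n * k) j k (subst (_≤ n * k + k) (sym (block-offset (n * k) x nk<x)) x≤nk+k)

  low-block : ∀ n x → n * k < x → x ≤ n * k + half → Low x
  low-block n x nk<x x≤ = subst (_< half) (sym (block-residue n x nk<x x≤nk+k))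
    (+-cancelˡ-< (n * k) _ half (subst (_≤ n * k + half) (sym (block-offset (n * k) x nk<x)) x≤))
    where
    x≤nk+k : x ≤ n * k + k
    x≤nk+k = ≤-trans x≤ (+-monoʳ-≤ (n * k) (m/n≤m k 2))

  high-block : ∀ n x → n * k + half < x → x ≤ n * k + k → ¬ Low x
  high-block n x nk+h<x x≤nk+k low = <⇒≱ (subst (_< half) (block-residue n x nk<x x≤nk+k) low) half≤j
    where
    nk<x : n * k < x
    nk<x = ≤-<-trans (m≤m+n (n * k) half) nk+h<x
    half≤j : half ≤ x ∸ suc (n * k)
    half≤j = +-cancelˡ-≤ (n * k) half _
               (≤-pred (subst (n * k + half <_) (sym (block-offset (n * k) x nk<x)) nk+h<x))

  below-midpoint : ∀ m x → 2 * x < 2 * m + k → x ≤ m + half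
  below-midpoint m x 2x<2m+k = *-cancelˡ-≤ 2 (≤-pred (begin
    suc (2 * x)              ≤⟨ 2x<2m+k ⟩
    2 * m + k                ≤⟨ +-monoʳ-≤ (2 * m) ≤twice-half+1 ⟩
    2 * m + suc (2 * half)   ≡⟨ +-suc (2 * m) (2 * half) ⟩
    suc (2 * m + 2 * half)   ≡⟨ cong suc (*-distribˡ-+ 2 m half) ⟨
    suc (2 * (m + half))     ∎))
    where open ≤-Reasoning

  above-midpoint : ∀ m x → 2 * m + k < 2 * x → m + half < x
  above-midpoint m x 2m+k<2x = *-cancelˡ-< 2 (m + half) x (begin-strict
    2 * (m + half)           ≡⟨ *-distribˡ-+ 2 m half ⟩
    2 * m + 2 * half         ≤⟨ +-monoʳ-≤ (2 * m) twice-half≤ ⟩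
    2 * m + k                <⟨ 2m+k<2x ⟩
    2 * x                    ∎)
    where open ≤-Reasoning

  residue-coprime : ∀ {x} → 1 ≤ x → Coprime x k → Coprime (suc (residue x)) k
  residue-coprime {suc x} _ cop {d} (d∣r+1 , d∣k) =
    cop (subst (d ∣_) x≡ (∣m∣n⇒∣m+n d∣r+1 (∣n⇒∣m*n (x / k) d∣k)) , d∣k)
    where
    x≡ : suc (x % k) + x / k * k ≡ suc x
    x≡ = cong suc (sym (m≡m%n+[m/n]*n x k))

  -- a unit a ≤ k/2 satisfies a + k/2 < k (for k > 2): the reflection a ↦ k - a lands above k/2
  reflect-bound : 2 < k → ∀ {a} → a ≤ half → Coprime a k → suc (a + half) ≤ k
  reflect-bound 2<k {a} a≤half cop = *-cancelˡ-< 2 (a + half) k (begin-strict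
    2 * (a + half)       ≡⟨ *-distribˡ-+ 2 a half ⟩
    2 * a + 2 * half     <⟨ +-mono-<-≤ 2a<k twice-half≤ ⟩
    k + k                ≡⟨ cong (k +_) (+-identityʳ k) ⟨
    2 * k                ∎)
    where
    open ≤-Reasoning
    2a≤k : 2 * a ≤ k
    2a≤k = ≤-trans (*-monoʳ-≤ 2 a≤half) twice-half≤
    -- 2a = k would make a a common divisor of a and k, forcing a = 1 and k = 2
    2a≢k : 2 * a ≢ k
    2a≢k 2a≡k = <⇒≢ 2<k (trans (sym (cong (2 *_) a≡1)) 2a≡k)
      where
      a≡1 : a ≡ 1
      a≡1 = cop (∣-refl , divides 2 (sym 2a≡k))
    2a<k : 2 * a < k
    2a<k = ≤∧≢⇒< 2a≤k 2a≢k

  complement-coprime : ∀ {a} → a ≤ k → Coprime a k → Coprime (k ∸ a) k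
  complement-coprime a≤k cop (d∣k-a , d∣k) =
    cop (∣m+n∣m⇒∣n (subst (_ ∣_) (sym (m∸n+n≡m a≤k)) d∣k) d∣k-a , d∣k)

  congruent⇒∣∸ : ∀ {a b} → a ≤ b → a % k ≡ b % k → k ∣ b ∸ a
  congruent⇒∣∸ {a} {b} a≤b a≡b = divides (b / k ∸ a / k) (begin
    b ∸ a                                       ≡⟨ cong₂ _∸_ b≡ (m≡m%n+[m/n]*n a k) ⟩
    (a % k + b / k * k) ∸ (a % k + a / k * k)   ≡⟨ [m+n]∸[m+o]≡n∸o (a % k) (b / k * k) (a / k * k) ⟩
    b / k * k ∸ a / k * k                       ≡⟨ *-distribʳ-∸ k (b / k) (a / k) ⟨
    (b / k ∸ a / k) * k                         ∎)
    where
    open ≡-Reasoning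
    b≡ : b ≡ a % k + b / k * k
    b≡ = trans (m≡m%n+[m/n]*n b k) (cong (_+ b / k * k) (sym a≡b))

  congruent⇒∣ : ∀ {a b} → a % k ≡ b % k → k ∣ ℤ.∣ a ℤ.⊖ b ∣
  congruent⇒∣ {a} {b} a≡b with ≤-total a b
  ... | inj₁ a≤b = subst (k ∣_) (sym (ℤ.∣⊖∣-≤ a≤b)) (congruent⇒∣∸ a≤b a≡b)
  ... | inj₂ b≤a = subst (k ∣_) (trans (sym (ℤ.∣⊖∣-≤ b≤a)) (ℤ.∣m⊖n∣≡∣n⊖m∣ b a))
                          (congruent⇒∣∸ b≤a (sym a≡b))

  residue-congruent⇒∣ : ∀ {q r} → 1 ≤ q → 1 ≤ r → residue q ≡ residue r →
                        (ℤ.+ k) ∣ℤ (ℤ.+ q ℤ.- ℤ.+ r)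
  residue-congruent⇒∣ {suc q} {suc r} _ _ same = subst (λ z → k ∣ ℤ.∣ z ∣) q−r≡ (congruent⇒∣ same)
    where
    q−r≡ : q ℤ.⊖ r ≡ ℤ.+ suc q ℤ.- ℤ.+ suc r
    q−r≡ = sym (trans (ℤ.[+m]-[+n]≡m⊖n (suc q) (suc r)) (ℤ.[1+m]⊖[1+n]≡m⊖n q r))

difference : ∀ {a b s} → ℤ.+ a ℤ.- ℤ.+ b ≡ ℤ.+ s → s + b ≡ a
difference {a} {b} {s} eq = ℤ.+-injective (begin
  ℤ.+ (s + b)                         ≡⟨ ℤ.pos-+ s b ⟩
  ℤ.+ s ℤ.+ ℤ.+ b                     ≡⟨ cong (ℤ._+ ℤ.+ b) eq ⟨
  (ℤ.+ a ℤ.- ℤ.+ b) ℤ.+ ℤ.+ b         ≡⟨ cancel (ℤ.+ a) (ℤ.+ b) ⟩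
  ℤ.+ a                               ∎)
  where
  open ≡-Reasoning
  cancel : ∀ (x y : ℤ) → (x ℤ.- y) ℤ.+ y ≡ x
  cancel = ℤ-Solver.solve-∀

module _ (k : ℕ) .{{_ : NonZero k}} where

  lowPrimes highPrimes : ℕ → ℕ
  lowPrimes  = count (prime? ∩? low? k)
  highPrimes = count (prime? ∩? high? k)

  bias : ℕ → ℤ
  bias N = ℤ.+ lowPrimes N ℤ.- ℤ.+ highPrimes N

  primeCount≡ : ∀ x → primeCount x ≡ count prime? (suc x)
  primeCount≡ x = count-filter prime? (λ y → y) (suc x)

  primeCount-split : ∀ x → primeCount x ≡ lowPrimes (suc x) + highPrimes (suc x)
  primeCount-split x = trans (primeCount≡ x) (count-split prime? (low? k) (suc x))

  lowPrimes-stable : ∀ n → lowPrimes (suc (n * k + k)) ≡ lowPrimes (suc (n * k + half k))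
  lowPrimes-stable n = count-stable (prime? ∩? low? k) (s≤s (+-monoʳ-≤ (n * k) (m/n≤m k 2)))
    (λ x above below (_ , low) → high-block k n x above (≤-pred below) low)

  highPrimes-stable : ∀ n → highPrimes (suc (n * k + half k)) ≡ highPrimes (suc (n * k))
  highPrimes-stable n = count-stable (prime? ∩? high? k) (s≤s (m≤m+n (n * k) (half k)))
    (λ x above below (_ , high) → high (low-block k n x above (≤-pred below)))

  midpoint : ∀ n → (2 * n * k + k) / 2 ≡ n * k + half k
  midpoint n = begin
    (2 * n * k + k) / 2        ≡⟨ cong (λ z → (z + k) / 2) (double n k) ⟩
    (n * k * 2 + k) / 2        ≡⟨ +-distrib-/-∣ˡ {n * k * 2} k {2} (n∣m*n (n * k)) ⟩
    n * k * 2 / 2 + k / 2      ≡⟨ cong (_+ half k) (m*n/n≡m (n * k) 2) ⟩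
    n * k + half k             ∎
    where
    open ≡-Reasoning
    double : ∀ n k → 2 * n * k ≡ n * k * 2
    double = solve-∀

  term≡Δbias : ∀ n → term k n ≡ bias (suc (n * k + k)) ℤ.- bias (suc (n * k))
  term≡Δbias n = begin
    ℤ.+ 2 ℤ.* ℤ.+ primeCount ((2 * n * k + k) / 2) ℤ.- ℤ.+ primeCount (n * k) ℤ.- ℤ.+ primeCount (n * k + k)
      ≡⟨ cong₂ (λ u v → ℤ.+ 2 ℤ.* ℤ.+ u ℤ.- ℤ.+ v ℤ.- ℤ.+ primeCount (n * k + k)) mid start ⟩
    ℤ.+ 2 ℤ.* ℤ.+ (aM + b₀) ℤ.- ℤ.+ (a₀ + b₀) ℤ.- ℤ.+ primeCount (n * k + k)
      ≡⟨ cong (λ w → ℤ.+ 2 ℤ.* ℤ.+ (aM + b₀) ℤ.- ℤ.+ (a₀ + b₀) ℤ.- ℤ.+ w) end ⟩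
    ℤ.+ 2 ℤ.* ℤ.+ (aM + b₀) ℤ.- ℤ.+ (a₀ + b₀) ℤ.- ℤ.+ (aM + b₁)
      ≡⟨ rearrange aM b₀ a₀ b₁ ⟩
    (ℤ.+ aM ℤ.- ℤ.+ b₁) ℤ.- (ℤ.+ a₀ ℤ.- ℤ.+ b₀)
      ≡⟨ cong (λ a → (ℤ.+ a ℤ.- ℤ.+ b₁) ℤ.- (ℤ.+ a₀ ℤ.- ℤ.+ b₀)) (lowPrimes-stable n) ⟨
    bias (suc (n * k + k)) ℤ.- bias (suc (n * k)) ∎
    where
    open ≡-Reasoning
    a₀ = lowPrimes (suc (n * k))
    b₀ = highPrimes (suc (n * k))
    aM = lowPrimes (suc (n * k + half k))
    b₁ = highPrimes (suc (n * k + k))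
    mid : primeCount ((2 * n * k + k) / 2) ≡ aM + b₀
    mid = trans (cong primeCount (midpoint n))
                (trans (primeCount-split (n * k + half k)) (cong (λ b → aM + b) (highPrimes-stable n)))
    start : primeCount (n * k) ≡ a₀ + b₀
    start = primeCount-split (n * k)
    end : primeCount (n * k + k) ≡ aM + b₁
    end = trans (primeCount-split (n * k + k)) (cong (_+ b₁) (lowPrimes-stable n))
    rearrange : ∀ a b c d → ℤ.+ 2 ℤ.* ℤ.+ (a + b) ℤ.- ℤ.+ (c + b) ℤ.- ℤ.+ (a + d)
                            ≡ (ℤ.+ a ℤ.- ℤ.+ d) ℤ.- (ℤ.+ c ℤ.- ℤ.+ b)
    rearrange a b c d rewrite ℤ.pos-+ a b | ℤ.pos-+ c b | ℤ.pos-+ a d =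
      identity (ℤ.+ a) (ℤ.+ b) (ℤ.+ c) (ℤ.+ d)
      where
      identity : ∀ (a b c d : ℤ) → ℤ.+ 2 ℤ.* (a ℤ.+ b) ℤ.- (c ℤ.+ b) ℤ.- (a ℤ.+ d)
                                   ≡ (a ℤ.- d) ℤ.- (c ℤ.- b)
      identity = ℤ-Solver.solve-∀

  sumTerms≡bias : ∀ M → sumTerms k M ≡ bias (suc (M * k))
  sumTerms≡bias zero    = refl
  sumTerms≡bias (suc M) = begin
    sumTerms k M ℤ.+ term k M
      ≡⟨ cong₂ ℤ._+_ (sumTerms≡bias M) (term≡Δbias M) ⟩
    bias (suc (M * k)) ℤ.+ (bias (suc (M * k + k)) ℤ.- bias (suc (M * k)))
      ≡⟨ cancel (bias (suc (M * k))) (bias (suc (M * k + k))) ⟩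
    bias (suc (M * k + k))
      ≡⟨ cong (bias ∘ suc) (+-comm (M * k) k) ⟩
    bias (suc (suc M * k)) ∎
    where
    open ≡-Reasoning
    cancel : ∀ (x y : ℤ) → x ℤ.+ (y ℤ.- x) ≡ y
    cancel = ℤ-Solver.solve-∀

  coprimeTo? : Decidable (λ x → Coprime x k)
  coprimeTo? x = coprime? x k

  coprimePrime? : Decidable (λ x → Prime x × Coprime x k)
  coprimePrime? = prime? ∩? coprimeTo?

  primeCoprimeCount≡ : ∀ n → primeCoprimeCount k n ≡ count coprimePrime? (suc n)
  primeCoprimeCount≡ n = count-filter coprimePrime? (λ x → x) (suc n)

  φ≡count : φ k ≡ count (coprimeTo? ∘ suc) k
  φ≡count = trans (cong (length ∘ filter coprimeTo?) (map-upTo suc k)) (count-filter coprimeTo? suc k)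

  primes-split : ∀ N → count prime? N ≡ count coprimePrime? N + count (primeDivisor? k) N
  primes-split N = trans (count-split prime? coprimeTo? N)
                         (cong (count coprimePrime? N +_) (count-cong (prime? ∩? ∁? coprimeTo?) (primeDivisor? k) N
                           (λ x _ → mk⇔ (λ (pr , ¬cop) → pr , noncoprime⇒prime∣ pr ¬cop)
                                        (λ (pr , x∣k) → pr , λ cop → coprime⇒prime∤ pr cop x∣k))))

  -- all prime divisors of k are ≤ k, so there are at most ω(k) of them below any bound
  divisors-stable : ∀ {N} → suc k ≤ N → count (primeDivisor? k) N ≡ ω k
  divisors-stable k<N =
    trans (count-stable (primeDivisor? k) k<N (λ x k<x _ (_ , x∣k) → <⇒≱ k<x (∣⇒≤ x∣k))) (sym (ω≡count k))

  divisors≤ω : ∀ N → count (primeDivisor? k) N ≤ ω k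
  divisors≤ω N = ≤-trans (count-monoʳ (primeDivisor? k) (m≤n+m N (suc k)))
                         (≤-reflexive (divisors-stable (m≤m+n (suc k) N)))

  -- 1 is a unit but not a prime, so fewer than φ(k) primes up to k are coprime to k
  coprimePrimes<φ : count coprimePrime? (suc k) < φ k
  coprimePrimes<φ = begin-strict
    count coprimePrime? (suc k)     ≡⟨ count-shift coprimePrime? k ⟩
    count (coprimePrime? ∘ suc) k   <⟨ count-strict (coprimePrime? ∘ suc) (coprimeTo? ∘ suc) (λ _ _ → proj₂)
                                                    (>-nonZero⁻¹ k) (1-coprimeTo k) 1-not-prime ⟩
    count (coprimeTo? ∘ suc) k      ≡⟨ φ≡count ⟨
    φ k                             ∎
    where
    open ≤-Reasoning
    1-not-prime : ¬ (Prime 1 × Coprime 1 k)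
    1-not-prime (pr , _) = contradiction (prime≥2 pr) λ { (s≤s ()) }

  module _ {p : ℕ} (p-th : IsNthPrime (φ k + ω k) p) where

    -- π(p) = φ(k) + ω(k) > π(k), so p > k
    k<p : k < p
    k<p = ≰⇒> λ p≤k → <⇒≢ (too-few p≤k) (proj₂ p-th)
      where
      too-few : p ≤ k → primeCount p < φ k + ω k
      too-few p≤k = begin-strict
        primeCount p                                                ≡⟨ primeCount≡ p ⟩
        count prime? (suc p)                                        ≤⟨ count-monoʳ prime? (s≤s p≤k) ⟩
        count prime? (suc k)                                        ≡⟨ primes-split (suc k) ⟩
        count coprimePrime? (suc k) + count (primeDivisor? k) (suc k) <⟨ +-monoˡ-< _ coprimePrimes<φ ⟩
        φ k + count (primeDivisor? k) (suc k)                       ≡⟨ cong (φ k +_) (divisors-stable ≤-refl) ⟩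
        φ k + ω k                                                   ∎
        where open ≤-Reasoning

    coprimePrimes≡φ : count coprimePrime? (suc p) ≡ φ k
    coprimePrimes≡φ = +-cancelʳ-≡ (ω k) _ _ (begin
      count coprimePrime? (suc p) + ω k
        ≡⟨ cong (count coprimePrime? (suc p) +_) (divisors-stable (s≤s (<⇒≤ k<p))) ⟨
      count coprimePrime? (suc p) + count (primeDivisor? k) (suc p) ≡⟨ primes-split (suc p) ⟨
      count prime? (suc p)                                           ≡⟨ primeCount≡ p ⟨
      primeCount p                                                   ≡⟨ proj₂ p-th ⟩
      φ k + ω k                                                      ∎)
      where open ≡-Reasoning

  lowCoprime highCoprime : ℕ → ℕ
  lowCoprime  = count (coprimePrime? ∩? low? k)
  highCoprime = count (coprimePrime? ∩? high? k)

  lowPrimes≤ : ∀ N → lowPrimes N ≤ lowCoprime N + ω k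
  lowPrimes≤ N = begin
    lowPrimes N
      ≡⟨ count-split (prime? ∩? low? k) coprimeTo? N ⟩
    count ((prime? ∩? low? k) ∩? coprimeTo?) N + count ((prime? ∩? low? k) ∩? ∁? coprimeTo?) N
      ≤⟨ +-mono-≤ (count-mono ((prime? ∩? low? k) ∩? coprimeTo?) (coprimePrime? ∩? low? k) N
                               (λ _ _ ((pr , low) , cop) → (pr , cop) , low))
                  (count-mono ((prime? ∩? low? k) ∩? ∁? coprimeTo?) (primeDivisor? k) N
                               (λ _ _ ((pr , _) , ¬cop) → pr , noncoprime⇒prime∣ pr ¬cop)) ⟩
    lowCoprime N + count (primeDivisor? k) N
      ≤⟨ +-monoʳ-≤ (lowCoprime N) (divisors≤ω N) ⟩
    lowCoprime N + ω k ∎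
    where open ≤-Reasoning

  highCoprime≤ : ∀ N → highCoprime N ≤ highPrimes N
  highCoprime≤ N =
    count-mono (coprimePrime? ∩? high? k) (prime? ∩? high? k) N (λ _ _ ((pr , _) , high) → pr , high)

  bias≤ω : ∀ N s → lowCoprime N ≤ highCoprime N → bias N ≡ ℤ.+ s → s ≤ ω k
  bias≤ω N s balanced bias≡s = +-cancelʳ-≤ (highCoprime N) s (ω k) (begin
    s + highCoprime N         ≤⟨ +-monoʳ-≤ s (highCoprime≤ N) ⟩
    s + highPrimes N          ≡⟨ difference bias≡s ⟩
    lowPrimes N               ≤⟨ lowPrimes≤ N ⟩
    lowCoprime N + ω k        ≤⟨ +-monoˡ-≤ (ω k) balanced ⟩
    highCoprime N + ω k       ≡⟨ +-comm (highCoprime N) (ω k) ⟩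
    ω k + highCoprime N       ∎)
    where
    open ≤-Reasoning

  -- units modulo k, as residues r < k of the classes r + 1, in the lower and upper half
  lowUnit? : Decidable (λ r → Coprime (suc r) k × r < half k)
  highUnit? : Decidable (λ r → Coprime (suc r) k × ¬ r < half k)
  lowUnit?  = (coprimeTo? ∘ suc) ∩? (λ r → r <? half k)
  highUnit? = (coprimeTo? ∘ suc) ∩? ∁? (λ r → r <? half k)

  -- a ↦ k − a maps lower-half units injectively to upper-half units
  lowUnits≤highUnits : 2 < k → count lowUnit? k ≤ count highUnit? k
  lowUnits≤highUnits 2<k = count-inj lowUnit? highUnit? reflect k k
    (λ r _ (cop , r<half) → let fits = room r cop r<half in
       ∸-monoʳ-< z<s (m+n≤o⇒n≤o (half k) fits) ,
       subst (λ a → Coprime a k) (+-∸-assoc 1 (m+n≤o⇒n≤o (half k) fits)) (complement-coprime k (<⇒≤ (m+n≤o⇒n≤o (half k) fits)) cop) ,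
       λ below → <⇒≱ below (m+n≤o⇒m≤o∸n (half k) fits))
    (λ x y _ _ (copx , x<h) (copy , y<h) same → suc-injective (suc-injective
       (∸-cancelˡ-≡ (m+n≤o⇒n≤o (half k) (room x copx x<h)) (m+n≤o⇒n≤o (half k) (room y copy y<h)) same)))
    where
    reflect : ℕ → ℕ
    reflect r = k ∸ suc (suc r)
    room : ∀ r → Coprime (suc r) k → r < half k → half k + suc (suc r) ≤ k
    room r cop r<half = ≤-trans (≤-reflexive (+-comm (half k) (suc (suc r)))) (reflect-bound k 2<k r<half cop)

  module _ {p : ℕ} (p-th : IsNthPrime (φ k + ω k) p) (P-int : PInteger k) where

    residue-injective : ∀ {q r} → q ≤ p → r ≤ p → Prime q × Coprime q k → Prime r × Coprime r k →
                        residue k q ≡ residue k r → q ≡ r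
    residue-injective {q} {r} q≤p r≤p cq@(prq , copq) cr@(prr , copr) same =
      count-rank-injective coprimePrime? cq cr
        (trans (sym (primeCoprimeCount≡ q))
          (trans (proj₂ P-int (rank q) (rank r) q r (rank≥1 cq) (rank≤φ q≤p) (rank≥1 cr) (rank≤φ r≤p)
                        (prq , copq , refl) (prr , copr , refl)
                        (residue-congruent⇒∣ k (positive prq) (positive prr) same))
                 (primeCoprimeCount≡ r)))
      where
      rank : ℕ → ℕ
      rank = primeCoprimeCount k
      positive : ∀ {x} → Prime x → 1 ≤ x
      positive pr = <⇒≤ (prime≥2 pr)
      rank≥1 : ∀ {x} → Prime x × Coprime x k → 1 ≤ rank x
      rank≥1 {x} cx = subst (1 ≤_) (sym (trans (primeCoprimeCount≡ x) (count-hit coprimePrime? cx))) (s≤s z≤n)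
      rank≤φ : ∀ {x} → x ≤ p → rank x ≤ φ k
      rank≤φ {x} x≤p = ≤-trans (≤-reflexive (primeCoprimeCount≡ x))
                               (≤-trans (count-monoʳ coprimePrime? (s≤s x≤p)) (≤-reflexive (coprimePrimes≡φ p-th)))

    lowCoprime≤lowUnits : lowCoprime (suc p) ≤ count lowUnit? k
    lowCoprime≤lowUnits = count-inj (coprimePrime? ∩? low? k) lowUnit? (residue k) (suc p) k
      (λ x _ ((pr , cop) , low) → m%n<n (x ∸ 1) k , residue-coprime k (<⇒≤ (prime≥2 pr)) cop , low)
      (λ x y x≤p y≤p (cx , _) (cy , _) → residue-injective (≤-pred x≤p) (≤-pred y≤p) cx cy)

    coprime-halves : lowCoprime (suc p) + highCoprime (suc p) ≡ count lowUnit? k + count highUnit? k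
    coprime-halves = begin
      lowCoprime (suc p) + highCoprime (suc p)   ≡⟨ count-split coprimePrime? (low? k) (suc p) ⟨
      count coprimePrime? (suc p)                ≡⟨ coprimePrimes≡φ p-th ⟩
      φ k                                        ≡⟨ φ≡count ⟩
      count (coprimeTo? ∘ suc) k                 ≡⟨ count-split (coprimeTo? ∘ suc) (λ r → r <? half k) k ⟩
      count lowUnit? k + count highUnit? k       ∎
      where open ≡-Reasoning

    balanced : 2 < k → lowCoprime (suc p) ≤ highCoprime (suc p)
    balanced 2<k = ≤-trans lowCoprime≤lowUnits (≤-trans (lowUnits≤highUnits 2<k) highUnits≤)
      where
      highUnits≤ : count highUnit? k ≤ highCoprime (suc p)
      highUnits≤ = +-cancelˡ-≤ (lowCoprime (suc p)) _ _ (begin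
        lowCoprime (suc p) + count highUnit? k      ≤⟨ +-monoˡ-≤ (count highUnit? k) lowCoprime≤lowUnits ⟩
        count lowUnit? k + count highUnit? k        ≡⟨ coprime-halves ⟨
        lowCoprime (suc p) + highCoprime (suc p)    ∎)
        where open ≤-Reasoning

    -- p in the lower half of (t k, t k + k): the primes in (t k, p] are all low
    balanced-up-to-tk : 2 < k → ∀ t → t * k < p → 2 * p < 2 * t * k + k →
                        lowCoprime (suc (t * k)) ≤ highCoprime (suc (t * k))
    balanced-up-to-tk 2<k t tk<p 2p<2tk+k = begin
      lowCoprime (suc (t * k))    ≤⟨ count-monoʳ (coprimePrime? ∩? low? k) (s≤s (<⇒≤ tk<p)) ⟩
      lowCoprime (suc p)          ≤⟨ balanced 2<k ⟩
      highCoprime (suc p)         ≡⟨ count-stable (coprimePrime? ∩? high? k) (s≤s (<⇒≤ tk<p)) low-between ⟩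
      highCoprime (suc (t * k))   ∎
      where
      open ≤-Reasoning
      low-between : ∀ x → suc (t * k) ≤ x → x < suc p → ¬ ((Prime x × Coprime x k) × ¬ Low k x)
      low-between x tk<x x≤p (_ , high) = high (low-block k t x tk<x (below-midpoint k (t * k) x (begin-strict
        2 * x             ≤⟨ *-monoʳ-≤ 2 (≤-pred x≤p) ⟩
        2 * p             <⟨ 2p<2tk+k ⟩
        2 * t * k + k     ≡⟨ cong (_+ k) (*-assoc 2 t k) ⟩
        2 * (t * k) + k   ∎)))

    -- p in the upper half of (t k, t k + k): the primes in (p, t k + k] are all high
    balanced-up-to-[t+1]k : 2 < k → ∀ t → p < suc t * k → 2 * t * k + k < 2 * p →
                            lowCoprime (suc (suc t * k)) ≤ highCoprime (suc (suc t * k))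
    balanced-up-to-[t+1]k 2<k t p<[t+1]k 2tk+k<2p = begin
      lowCoprime (suc (suc t * k))
        ≡⟨ count-stable (coprimePrime? ∩? low? k) (s≤s (<⇒≤ p<[t+1]k)) high-between ⟩
      lowCoprime (suc p)              ≤⟨ balanced 2<k ⟩
      highCoprime (suc p)             ≤⟨ count-monoʳ (coprimePrime? ∩? high? k) (s≤s (<⇒≤ p<[t+1]k)) ⟩
      highCoprime (suc (suc t * k))   ∎
      where
      open ≤-Reasoning
      high-between : ∀ x → suc p ≤ x → x < suc (suc t * k) → ¬ ((Prime x × Coprime x k) × Low k x)
      high-between x p<x x≤[t+1]k (_ , low) = high-block k t x
        (above-midpoint k (t * k) x (begin-strict
          2 * (t * k) + k   ≡⟨ cong (_+ k) (*-assoc 2 t k) ⟨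
          2 * t * k + k     <⟨ 2tk+k<2p ⟩
          2 * p             <⟨ *-monoʳ-< 2 p<x ⟩
          2 * x             ∎))
        (≤-trans (≤-pred x≤[t+1]k) (≤-reflexive (+-comm k (t * k))))
        low

open import Data.Integer using (+_)

-- for a P-integer k > 2 the sum S_L is at most ω(k): it is the bias of the primes up to (L + 1) k,
-- and the coprime primes up to there are balanced
S≤ω : ∀ k .{{_ : NonZero k}} → 2 < k → ∀ {p t M s} → IsNthPrime (φ k + ω k) p →
      t * k < p → p < suc t * k →
      ((M ≡ t × 2 * p < 2 * t * k + k) ⊎ (M ≡ suc t × 2 * t * k + k < 2 * p)) →
      sumTerms k M ≡ + s → PInteger k → s ≤ ω k
S≤ω k 2<k {t = t} {s = s} p-th tk<p _ (inj₁ (refl , lower)) S≡s P-int =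
  bias≤ω k (suc (t * k)) s (balanced-up-to-tk k p-th P-int 2<k t tk<p lower)
         (trans (sym (sumTerms≡bias k t)) S≡s)
S≤ω k 2<k {t = t} {s = s} p-th _ p<[t+1]k (inj₂ (refl , upper)) S≡s P-int =
  bias≤ω k (suc (suc t * k)) s (balanced-up-to-[t+1]k k p-th P-int 2<k t p<[t+1]k upper)
         (trans (sym (sumTerms≡bias k (suc t))) S≡s)

lemma3p1 : (k : ℕ) → 30 < k →
           (p t M : ℕ) → IsNthPrime (φ k + ω k) p →
           t * k < p → p < suc t * k →
           ((M ≡ t × 2 * p < 2 * t * k + k) ⊎ (M ≡ suc t × 2 * t * k + k < 2 * p)) →
           (s : ℕ) → sumTerms k M ≡ + s → LogLt k s →
           ¬ PInteger k
-- S_L = s ≤ ω(k) gives (s + 1)! ≤ (ω(k) + 1)! ≤ k, hence s ≤ log k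
lemma3p1 k 30<k p t M p-th tk<p p<[t+1]k position s S≡s log-k<s P-int =
  log-lower-bound 30<k [s+1]!≤k log-k<s
  where
  0<k : 0 < k
  0<k = ≤-trans z<s 30<k
  instance
    k≢0 : NonZero k
    k≢0 = >-nonZero 0<k
  s≤ω : s ≤ ω k
  s≤ω = S≤ω k (≤-trans (s≤s (s≤s (s≤s z≤n))) 30<k) p-th tk<p p<[t+1]k position S≡s P-int
  [s+1]!≤k : (suc s) ! ≤ k
  [s+1]!≤k = ≤-trans (factorial-mono (s≤s s≤ω)) (omega-factorial 0<k)
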